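{- Let $\mathcal{H}\subseteq 2^{[n]}\setminus\{\emptyset\}$ be a minimally transversal-free hypergraph. Then for every integer $k\in\mathbb{Z}_+$, $N(k)\cup P(k)=\{x\in\mathbb{Z}_+^n: m(x)=k\}$.
   Context: Hypergraph NIM $\mathrm{NIM}_{\mathcal{H}}$: positions are $x\in\mathbb{Z}_+^n$; $x\to x'$ is a move iff $x\ge x'$ componentwise and $\{i: x'_i<x_i\}\in\mathcal{H}$. For a hypergraph $\mathcal{F}$, $\mathcal{F}^t=\{T\subseteq[n]: T\cap F\neq\emptyset\ \forall F\in\mathcal{F}\}$. For $S\subseteq[n]$, $\mathcal{H}_S=\{H\in\mathcal{H}: H\subseteq S\}$. $\mathcal{H}$ is minimally transversal-free (MTF) if $\mathcal{H}\cap\mathcal{H}^t=\emptyset$ and for every nonempty proper subset $S\subsetneq[n]$ there is $H\in\mathcal{H}_S$ with $H\in(\mathcal{H}_S)^t$. For a position $x$: $m(x)=\min_i x_i$, $M(x)=\{i: x_i=m(x)\}$. For $k\in\mathbb{Z}_+$: $P(k)=\{x: m(x)=k,\ M(x)\in\mathcal{H}^t\}$ and $N(k)=\{x: \text{there is a move } x\to x' \text{ with } x'\in P(k)\}$. -}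

module Defs where

open import Data.Nat using (ℕ; _≤_; _<_)
open import Data.Fin using (Fin)
open import Data.Fin.Subset using (Subset; _∩_; _⊆_; Nonempty; ⊤; inside; outside)
import Data.Fin.Subset as S
open import Data.Vec using (tabulate)
open import Data.List using (List)
open import Data.List.Membership.Propositional using (_∈_)
open import Data.Product using (Σ; ∃; _×_; _,_)
open import Data.Bool using (if_then_else_)
open import Relation.Nullary using (¬_; does)
open import Relation.Binary.PropositionalEquality using (_≡_; _≢_)
open import Data.Nat using (_≟_; _<?_)

Hypergraph : ℕ → Set
Hypergraph n = List (Subset n)

NoEmptyEdge : ∀ {n} → Hypergraph n → Set
NoEmptyEdge ℋ = ∀ {H} → H ∈ ℋ → Nonempty H

IsTransversal : ∀ {n} → Hypergraph n → Subset n → Set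
IsTransversal ℱ T = ∀ {F} → F ∈ ℱ → Nonempty (T ∩ F)

InRestriction : ∀ {n} → Hypergraph n → Subset n → Subset n → Set
InRestriction ℋ S H = (H ∈ ℋ) × (H ⊆ S)

IsTransversalRestr : ∀ {n} → Hypergraph n → Subset n → Subset n → Set
IsTransversalRestr ℋ S T = ∀ {F} → InRestriction ℋ S F → Nonempty (T ∩ F)

MTF : ∀ {n} → Hypergraph n → Set
MTF {n} ℋ =
  (∀ {H} → H ∈ ℋ → ¬ IsTransversal ℋ H)
  × (∀ (S : Subset n) → Nonempty S → S ≢ ⊤ →
       ∃ λ H → InRestriction ℋ S H × IsTransversalRestr ℋ S H)

Position : ℕ → Set
Position n = Fin n → ℕ

MinIs : ∀ {n} → Position n → ℕ → Set
MinIs x k = (∀ i → k ≤ x i) × (∃ λ i → x i ≡ k)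

-- {i : x_i = k}; equals M(x) when m(x) = k
MinSet : ∀ {n} → Position n → ℕ → Subset n
MinSet x k = tabulate (λ i → if does (x i ≟ k) then inside else outside)

Move : ∀ {n} → Hypergraph n → Position n → Position n → Set
Move {n} ℋ x x' =
  (∀ i → x' i ≤ x i)
  × (tabulate (λ i → if does (x' i <? x i) then inside else outside) ∈ ℋ)

PSet : ∀ {n} → Hypergraph n → ℕ → Position n → Set
PSet ℋ k x = MinIs x k × IsTransversal ℋ (MinSet x k)

NSet : ∀ {n} → Hypergraph n → ℕ → Position n → Set
NSet ℋ k x = ∃ λ x' → Move ℋ x x' × PSet ℋ k x'

{-# OPTIONS --safe #-}
module Submission where

-- Let M = M(x) ⊆ [n] be the coordinates attaining the minimum k.
-- If some move x → x' reaches P(k), the edge H of the move contains M(x') unless x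
-- already attains k, and would then be a transversal, which MTF forbids; so m(x) = k.
-- Conversely, if m(x) = k and M ≠ [n], MTF applied to S = [n] ∖ M gives an edge
-- H ⊆ S meeting every edge inside S.  Lowering the coordinates in H to k is a move,
-- and its minimum set M ∪ H is a transversal: an edge missing M lies inside S and so
-- meets H.  If M = [n], then M is a transversal because no edge is empty.

open import Defs
open import Level using (Level)
open import Data.Nat using (ℕ; _≤_; _<_; _≟_; _<?_)
open import Data.Nat.Properties using (≤-trans; ≤-refl; <-irrefl; ≤∧≢⇒<)
open import Data.Sum using (_⊎_; inj₁; inj₂; [_,_])
open import Data.Product using (_×_; _,_; ∃; proj₁)
open import Data.Fin using (Fin)
open import Data.Fin.Subset using (Subset; _∈_; _⊆_; _∩_; _∪_; ∁; ⊤; Nonempty; Empty; inside; outside)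
open import Data.Fin.Subset.Properties
  using (_∈?_; nonempty?; ∈⊤; ⊆-antisym; x∈p∩q⁺; x∈p∩q⁻; p⊆p∪q; q⊆p∪q; x∈p∪q⁻;
         x∈p⇒x∉∁p; x∉∁p⇒x∈p; x∉p⇒x∈∁p)
open import Data.Fin.Properties using (any?)
open import Data.Vec using (tabulate)
open import Data.Vec.Properties using (lookup∘tabulate; []=⇒lookup; lookup⇒[]=)
open import Data.Empty using (⊥-elim)
open import Data.Bool using (if_then_else_)
open import Data.List.Membership.Propositional using () renaming (_∈_ to _∈ₗ_)
open import Relation.Nullary using (¬_; Dec; yes; no; does; contradiction)
open import Relation.Nullary.Decidable using (dec-true)
open import Relation.Unary using (Pred; Decidable)
open import Relation.Binary.PropositionalEquality using (_≡_; _≢_; refl; sym; trans; cong; subst)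

private
  variable
    ℓ : Level
    n k : ℕ
    p q T T′ H : Subset n
    ℋ : Hypergraph n
    x x′ : Position n

decSubset : {P : Pred (Fin n) ℓ} → Decidable P → Subset n
decSubset d = tabulate (λ i → if does (d i) then inside else outside)

∈-decSubset⁺ : {P : Pred (Fin n) ℓ} (d : Decidable P) → ∀ {i} → P i → i ∈ decSubset d
∈-decSubset⁺ d {i} pᵢ =
  lookup⇒[]= i _ (trans (lookup∘tabulate _ i) (cong (λ b → if b then inside else outside) (dec-true (d i) pᵢ)))

∈-decSubset⁻ : {P : Pred (Fin n) ℓ} (d : Decidable P) → ∀ {i} → i ∈ decSubset d → P i
∈-decSubset⁻ d {i} i∈ = inside⇒holds (d i) (trans (sym (lookup∘tabulate _ i)) ([]=⇒lookup i∈))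
  where
  inside⇒holds : ∀ {A : Set ℓ} (a? : Dec A) → (if does a? then inside else outside) ≡ inside → A
  inside⇒holds (yes a) _ = a
  inside⇒holds (no _) ()

decreasedSet : Position n → Position n → Subset n
decreasedSet x x′ = decSubset (λ i → x′ i <? x i)

Empty-∩⇒⊆∁ : Empty (p ∩ q) → q ⊆ ∁ p
Empty-∩⇒⊆∁ p∩q-empty i∈q = x∉p⇒x∈∁p (λ i∈p → p∩q-empty (_ , x∈p∩q⁺ (i∈p , i∈q)))

Empty-∁⇒⊤⊆ : Empty (∁ p) → ⊤ ⊆ p
Empty-∁⇒⊤⊆ ∁p-empty _ = x∉∁p⇒x∈p (λ i∈∁p → ∁p-empty (_ , i∈∁p))

∈⇒∁≢⊤ : ∀ {i} → i ∈ p → ∁ p ≢ ⊤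
∈⇒∁≢⊤ {i = i} i∈p ∁p≡⊤ = x∈p⇒x∉∁p i∈p (subst (i ∈_) (sym ∁p≡⊤) ∈⊤)

∩-meets-⊆ : ∀ {F} → T ⊆ T′ → Nonempty (T ∩ F) → Nonempty (T′ ∩ F)
∩-meets-⊆ {T = T} {F = F} T⊆T′ (i , i∈T∩F) with x∈p∩q⁻ T F i∈T∩F
... | i∈T , i∈F = i , x∈p∩q⁺ (T⊆T′ i∈T , i∈F)

IsTransversal-resp-⊆ : T ⊆ T′ → IsTransversal ℋ T → IsTransversal ℋ T′
IsTransversal-resp-⊆ T⊆T′ τ F∈ℋ = ∩-meets-⊆ T⊆T′ (τ F∈ℋ)

⊤-IsTransversal : NoEmptyEdge ℋ → IsTransversal ℋ ⊤
⊤-IsTransversal noEmpty F∈ℋ with noEmpty F∈ℋ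
... | i , i∈F = i , x∈p∩q⁺ (∈⊤ , i∈F)

∪-IsTransversal : IsTransversalRestr ℋ (∁ p) H → IsTransversal ℋ (p ∪ H)
∪-IsTransversal {p = p} {H = H} τ {F} F∈ℋ with nonempty? (p ∩ F)
... | yes p-meets-F = ∩-meets-⊆ (p⊆p∪q H) p-meets-F
... | no p∩F-empty = ∩-meets-⊆ (q⊆p∪q p H) (τ (F∈ℋ , Empty-∩⇒⊆∁ p∩F-empty))

minSet⊆decreasedSet : (∀ i → x i ≢ k) → (∀ i → x′ i ≤ x i) → MinSet x′ k ⊆ decreasedSet x x′
minSet⊆decreasedSet {x = x} {k = k} {x′ = x′} x≢k x′≤x {i} i∈min =
  ∈-decSubset⁺ (λ j → x′ j <? x j) (≤∧≢⇒< (x′≤x i) (λ x′ᵢ≡xᵢ → x≢k i (trans (sym x′ᵢ≡xᵢ) x′ᵢ≡k)))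
  where
  x′ᵢ≡k : x′ i ≡ k
  x′ᵢ≡k = ∈-decSubset⁻ (λ j → x′ j ≟ k) i∈min

NSet⇒MinIs : (∀ {H} → H ∈ₗ ℋ → ¬ IsTransversal ℋ H) → NSet ℋ k x → MinIs x k
NSet⇒MinIs {ℋ = ℋ} {k = k} {x = x} noTransversalEdge (x′ , (x′≤x , decreased∈ℋ) , (k≤x′ , _) , τ) =
  (λ i → ≤-trans (k≤x′ i) (x′≤x i)) , attained
  where
  attained : ∃ λ i → x i ≡ k
  attained with any? (λ i → x i ≟ k)
  ... | yes x-attains-k = x-attains-k
  ... | no ¬x-attains-k =
    ⊥-elim (noTransversalEdge decreased∈ℋ
      (IsTransversal-resp-⊆ (minSet⊆decreasedSet (λ i xᵢ≡k → ¬x-attains-k (i , xᵢ≡k)) x′≤x) τ))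

lowerOn : Subset n → ℕ → Position n → Position n
lowerOn H k x i = if does (i ∈? H) then k else x i

lowerOn-≤ : (∀ i → k ≤ x i) → ∀ i → lowerOn H k x i ≤ x i
lowerOn-≤ {H = H} k≤x i with i ∈? H
... | yes _ = k≤x i
... | no _ = ≤-refl

lowerOn-≥ : (∀ i → k ≤ x i) → ∀ i → k ≤ lowerOn H k x i
lowerOn-≥ {H = H} k≤x i with i ∈? H
... | yes _ = ≤-refl
... | no _ = k≤x i

decreasedSet-lowerOn : (∀ {i} → i ∈ H → k < x i) → decreasedSet x (lowerOn H k x) ≡ H
decreasedSet-lowerOn {H = H} {k = k} {x = x} k<x = ⊆-antisym decreased⊆H H⊆decreased
  where
  decreased⊆H : decreasedSet x (lowerOn H k x) ⊆ H
  decreased⊆H {i} i∈ with i ∈? H | ∈-decSubset⁻ (λ j → lowerOn H k x j <? x j) i∈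
  ... | yes i∈H | _ = i∈H
  ... | no _ | xᵢ<xᵢ = contradiction xᵢ<xᵢ (<-irrefl refl)
  H⊆decreased : H ⊆ decreasedSet x (lowerOn H k x)
  H⊆decreased {i} i∈H = ∈-decSubset⁺ (λ j → lowerOn H k x j <? x j) (lowered<x (i ∈? H))
    where
    lowered<x : (i∈?H : Dec (i ∈ H)) → (if does i∈?H then k else x i) < x i
    lowered<x (yes _) = k<x i∈H
    lowered<x (no i∉H) = contradiction i∈H i∉H

minSet-∪⊆minSet-lowerOn : MinSet x k ∪ H ⊆ MinSet (lowerOn H k x) k
minSet-∪⊆minSet-lowerOn {x = x} {k = k} {H = H} {i} i∈ =
  ∈-decSubset⁺ (λ j → lowerOn H k x j ≟ k) (lowered≡k (i ∈? H) (x∈p∪q⁻ (MinSet x k) H i∈))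
  where
  lowered≡k : (i∈?H : Dec (i ∈ H)) → i ∈ MinSet x k ⊎ i ∈ H → (if does i∈?H then k else x i) ≡ k
  lowered≡k (yes _) _ = refl
  lowered≡k (no _) (inj₁ i∈min) = ∈-decSubset⁻ (λ j → x j ≟ k) i∈min
  lowered≡k (no i∉H) (inj₂ i∈H) = contradiction i∈H i∉H

lowerOn-MinIs : MinIs x k → MinIs (lowerOn H k x) k
lowerOn-MinIs {x = x} {k = k} {H = H} (k≤x , j , xⱼ≡k) =
  lowerOn-≥ k≤x , j , ∈-decSubset⁻ (λ i → lowerOn H k x i ≟ k) (minSet-∪⊆minSet-lowerOn j∈min∪H)
  where
  j∈min∪H : j ∈ MinSet x k ∪ H
  j∈min∪H = p⊆p∪q H (∈-decSubset⁺ (λ i → x i ≟ k) xⱼ≡k)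

∈∁minSet⇒< : (∀ i → k ≤ x i) → ∀ {i} → i ∈ ∁ (MinSet x k) → k < x i
∈∁minSet⇒< {k = k} {x = x} k≤x {i} i∈∁min =
  ≤∧≢⇒< (k≤x i) (λ k≡xᵢ → x∈p⇒x∉∁p (∈-decSubset⁺ (λ j → x j ≟ k) (sym k≡xᵢ)) i∈∁min)

lowerOn∈NSet : MinIs x k → H ∈ₗ ℋ → H ⊆ ∁ (MinSet x k) → IsTransversalRestr ℋ (∁ (MinSet x k)) H →
               NSet ℋ k x
lowerOn∈NSet {x = x} {k = k} {H = H} {ℋ = ℋ} min@(k≤x , _) H∈ℋ H⊆∁min τ =
  lowerOn H k x ,
  (lowerOn-≤ k≤x , subst (_∈ₗ ℋ) (sym (decreasedSet-lowerOn (λ i∈H → ∈∁minSet⇒< k≤x (H⊆∁min i∈H)))) H∈ℋ) ,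
  lowerOn-MinIs min ,
  IsTransversal-resp-⊆ minSet-∪⊆minSet-lowerOn (∪-IsTransversal τ)

MinIs⇒NSet⊎PSet : NoEmptyEdge ℋ → MTF ℋ → MinIs x k → NSet ℋ k x ⊎ PSet ℋ k x
MinIs⇒NSet⊎PSet {x = x} {k = k} noEmpty (_ , restrictedTransversal) min@(_ , j , xⱼ≡k)
  with nonempty? (∁ (MinSet x k))
... | no ∁min-empty = inj₂ (min , IsTransversal-resp-⊆ (Empty-∁⇒⊤⊆ ∁min-empty) (⊤-IsTransversal noEmpty))
... | yes ∁min-nonempty
  with restrictedTransversal (∁ (MinSet x k)) ∁min-nonempty (∈⇒∁≢⊤ (∈-decSubset⁺ (λ i → x i ≟ k) xⱼ≡k))
...   | H , (H∈ℋ , H⊆∁min) , τ = inj₁ (lowerOn∈NSet min H∈ℋ H⊆∁min τ)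

mainTheorem7 : ∀ {n} (ℋ : Hypergraph n) → NoEmptyEdge ℋ → MTF ℋ →
    ∀ (k : ℕ) (x : Position n) →
      ((NSet ℋ k x ⊎ PSet ℋ k x) → MinIs x k) × (MinIs x k → NSet ℋ k x ⊎ PSet ℋ k x)
mainTheorem7 ℋ noEmpty mtf k x = [ NSet⇒MinIs (proj₁ mtf) , proj₁ ] , MinIs⇒NSet⊎PSet noEmpty mtf
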